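{- For all integers $n\ge0$ and $i\ge0$, the sequence $n\!\uparrow\! i$ has length $\binom{n+i}{i}$ and the sum of its entries is $\binom{n+i}{i+1}$.
   Context: For integers $m,i\ge0$ the finite sequence $m\!\uparrow\! i$ is defined by $m\!\uparrow\!0=(m)$, $0\!\uparrow\! i=(0)$, and $m\!\uparrow\! i=(m\!\uparrow\!(i-1))\cdot((m-1)\!\uparrow\! i)$ for $m,i\ge1$, where $\cdot$ denotes concatenation of sequences. E.g. $4\!\uparrow\!1=(4,3,2,1,0)$ and $3\!\uparrow\!2=(3,2,1,0,2,1,0,1,0,0)$. -}

module Defs where

open import Data.Nat using (ℕ; zero; suc)
open import Data.List using (List; []; _∷_; _++_)

_↑_ : ℕ → ℕ → List ℕ
m ↑ zero = m ∷ []
zero ↑ suc i = zero ∷ []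
suc m ↑ suc i = (suc m ↑ i) ++ (m ↑ suc i)

-- Both identities follow by induction along the defining recursion of m ↑ i:
-- length and sum turn concatenation into addition, and Pascal's rule
-- (N C k) + (N C (k+1)) = (N+1) C (k+1) closes the step, with N = m + (i+1).
module Submission where

open import Defs
open import Data.Nat using (ℕ; _+_; suc; zero)
open import Data.Nat.Combinatorics
  using (_C_; nC1≡n; nCn≡1; k>n⇒nCk≡0; nCk+nC[k+1]≡[n+1]C[k+1])
open import Data.Nat.Properties using (+-identityʳ; +-suc; n<1+n)
open import Data.List using (length; _++_)
open import Data.List.Properties using (length-++)
open import Data.Nat.ListAction using (sum)
open import Data.Nat.ListAction.Properties using (sum-++)
open import Data.Product using (_×_; _,_)
open import Relation.Binary.PropositionalEquality
  using (_≡_; refl; sym; cong; cong₂; module ≡-Reasoning)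
open ≡-Reasoning

pascal-step : ∀ m i k → (suc m + i) C k + (m + suc i) C suc k ≡ (suc m + suc i) C suc k
pascal-step m i k = begin
  (suc m + i) C k + (m + suc i) C suc k     ≡⟨ cong (λ N → N C k + (m + suc i) C suc k) (+-suc m i) ⟨
  (m + suc i) C k + (m + suc i) C suc k     ≡⟨ nCk+nC[k+1]≡[n+1]C[k+1] (m + suc i) k ⟩
  (suc m + suc i) C suc k                   ∎

length-↑ : ∀ n i → length (n ↑ i) ≡ (n + i) C i
length-↑ n       zero    = cong (_C 0) (sym (+-identityʳ n))
length-↑ zero    (suc i) = sym (nCn≡1 (suc i))
length-↑ (suc m) (suc i) = begin
  length ((suc m ↑ i) ++ (m ↑ suc i))            ≡⟨ length-++ (suc m ↑ i) ⟩
  length (suc m ↑ i) + length (m ↑ suc i)        ≡⟨ cong₂ _+_ (length-↑ (suc m) i) (length-↑ m (suc i)) ⟩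
  (suc m + i) C i + (m + suc i) C suc i          ≡⟨ pascal-step m i i ⟩
  (suc m + suc i) C suc i                        ∎

sum-↑ : ∀ n i → sum (n ↑ i) ≡ (n + i) C suc i
sum-↑ n       zero    = begin
  n + 0           ≡⟨ +-identityʳ n ⟩
  n               ≡⟨ nC1≡n n ⟨
  n C 1           ≡⟨ cong (_C 1) (+-identityʳ n) ⟨
  (n + 0) C 1     ∎
sum-↑ zero    (suc i) = sym (k>n⇒nCk≡0 (n<1+n (suc i)))
sum-↑ (suc m) (suc i) = begin
  sum ((suc m ↑ i) ++ (m ↑ suc i))                 ≡⟨ sum-++ (suc m ↑ i) (m ↑ suc i) ⟩
  sum (suc m ↑ i) + sum (m ↑ suc i)                ≡⟨ cong₂ _+_ (sum-↑ (suc m) i) (sum-↑ m (suc i)) ⟩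
  (suc m + i) C suc i + (m + suc i) C suc (suc i)  ≡⟨ pascal-step m i (suc i) ⟩
  (suc m + suc i) C suc (suc i)                    ∎

lemma4p25 : ∀ (n i : ℕ) → length (n ↑ i) ≡ (n + i) C i × sum (n ↑ i) ≡ (n + i) C (suc i)
lemma4p25 n i = length-↑ n i , sum-↑ n i
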